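{- In the setting below, there exist a natural transformation $\epsilon\colon U\circ M\Rightarrow U$ whose components lie above the projections $\pi_1\colon X\times\mathbb{N}\to X$, and a vertical natural transformation $\alpha\colon U\circ\hat F^{\mathbb{N}}\Rightarrow \hat F\circ U$ (components lying above identities), such that, with $\gamma:=(\hat F*\epsilon)\circ(\alpha*M)\colon U\circ\hat F^{\mathbb{N}}\circ M\Rightarrow \hat F\circ U$, the square of functors $$\mathrm{Coalg}(U)_\gamma\colon \mathrm{Coalg}(\hat F^{\mathbb{N}}\circ M)\to\mathrm{Coalg}(\hat F),\qquad \mathrm{Coalg}(p)\colon\mathrm{Coalg}(\hat F)\to\mathrm{Coalg}(F),$$ $$\mathrm{Coalg}(q)\colon \mathrm{Coalg}(\hat F^{\mathbb{N}}\circ M)\to\mathrm{Coalg}(F(-\times\mathbb{N})),\qquad \mathrm{Coalg}(\mathrm{id})_{F\pi_1}\colon \mathrm{Coalg}(F(-\times\mathbb{N}))\to\mathrm{Coalg}(F)$$ commutes, i.e. $\mathrm{Coalg}(p)\circ\mathrm{Coalg}(U)_\gamma=\mathrm{Coalg}(\mathrm{id})_{F\pi_1}\circ\mathrm{Coalg}(q)$. (Here $*$ is horizontal and $\circ$ vertical composition of natural transformations.)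
   Context: Let $\Sigma$ be a set, $2=\{\mathrm{False}\le\mathrm{True}\}$, and $F:=2\times(-)^\Sigma\colon\mathbf{Set}\to\mathbf{Set}$. Let $\mathbf{Rel}$ be the category whose objects are pairs $(X,R)$ with $R\subseteq X\times X$ and whose morphisms $(X,R)\to(Y,Q)$ are functions $f\colon X\to Y$ with $(x_1,x_2)\in R\Rightarrow(fx_1,fx_2)\in Q$; $p\colon\mathbf{Rel}\to\mathbf{Set}$ is the forgetful functor. Let $\mathbf{Rel}^{\mathbb{N}}_\Delta$ be the category whose objects are pairs $(X,\{\mathcal{A}_n\}_{n\in\mathbb{N}})$ with each $\mathcal{A}_n\subseteq X\times X$, and whose morphisms are functions $f\colon X\to Y$ preserving the relation at each grade; $q\colon\mathbf{Rel}^{\mathbb{N}}_\Delta\to\mathbf{Set}$ is the forgetful functor. A morphism is said to lie above a function $f$ if its underlying function is $f$. Let $U\colon\mathbf{Rel}^{\mathbb{N}}_\Delta\to\mathbf{Rel}$, $U(X,\mathcal{A})=(X,\bigcup_n\mathcal{A}_n)$, identity on underlying functions. Define functors (identity on underlying functions): $\hat F(X,R)=(FX,\{((b_1,\tau_1),(b_2,\tau_2))\mid b_1\le b_2,\ \forall a\in\Sigma.\ (\tau_1(a),\tau_2(a))\in R\})$; $\hat F^{\mathbb{N}}(X,\mathcal{A})=(FX,\{\hat F^{\mathbb{N}}(\mathcal{A})_n\}_n)$ with $\hat F^{\mathbb{N}}(\mathcal{A})_n=\{((b_1,\tau_1),(b_2,\tau_2))\mid b_1\le b_2,\ \forall a\in\Sigma.\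 (\tau_1(a),\tau_2(a))\in\mathcal{A}_n\}$; $M(X,\mathcal{A})=(X\times\mathbb{N},\{M(\mathcal{A})_n\}_n)$ with $M(\mathcal{A})_n=\{((s_1,n_1),(s_2,n_2))\mid n_1\le n+n_2,\ (s_1,s_2)\in\mathcal{A}_{n-n_1+n_2}\}$. For an endofunctor $G$, $\mathrm{Coalg}(G)$ is the category of $G$-coalgebras and homomorphisms. For functors $G\colon\mathbf{A}\to\mathbf{A}$, $G'\colon\mathbf{B}\to\mathbf{B}$, $H\colon\mathbf{A}\to\mathbf{B}$ and a natural transformation $\beta\colon HG\Rightarrow G'H$, $\mathrm{Coalg}(H)_\beta\colon\mathrm{Coalg}(G)\to\mathrm{Coalg}(G')$ sends $c\colon X\to GX$ to $\beta_X\circ Hc$ and a homomorphism $f$ to $Hf$; $\mathrm{Coalg}(H)$ means $\mathrm{Coalg}(H)_{\mathrm{id}}$ when $HG=G'H$. Note $p\hat F=Fp$ and $q\hat F^{\mathbb{N}}M=F(-\times\mathbb{N})q$. -}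

module Defs where

open import Data.Bool.Base using (Bool) renaming (_≤_ to _≤ᵇ_)
open import Data.Nat.Base using (ℕ; _+_; _∸_; _≤_)
open import Data.Product.Base using (Σ; ∃; _×_; _,_; proj₁; proj₂)
open import Relation.Binary.PropositionalEquality using (_≡_; refl; sym; trans; cong)

-- Everything is parametrised by the alphabet Σ (called Sig here).
module Setting (Sig : Set) where

  F₀ : Set → Set
  F₀ X = Bool × (Sig → X)

  F₁ : ∀ {X Y : Set} → (X → Y) → F₀ X → F₀ Y
  F₁ f u = proj₁ u , (λ a → f (proj₂ u a))

  -- equality of elements of F X (functions Σ → X compared extensionally,
  -- as in Set)
  _≈F_ : ∀ {X : Set} → F₀ X → F₀ X → Set
  u ≈F v = (proj₁ u ≡ proj₁ v) × (∀ a → proj₂ u a ≡ proj₂ v a)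

  ≈F-refl : ∀ {X} {u : F₀ X} → u ≈F u
  ≈F-refl = refl , (λ a → refl)

  ≈F-sym : ∀ {X} {u v : F₀ X} → u ≈F v → v ≈F u
  ≈F-sym (p , q) = sym p , (λ a → sym (q a))

  ≈F-trans : ∀ {X} {u v w : F₀ X} → u ≈F v → v ≈F w → u ≈F w
  ≈F-trans (p , q) (p' , q') = trans p p' , (λ a → trans (q a) (q' a))

  F₁-resp : ∀ {X Y} (f : X → Y) {u v : F₀ X} → u ≈F v → F₁ f u ≈F F₁ f v
  F₁-resp f (p , q) = p , (λ a → cong f (q a))

  _×id : ∀ {X Y : Set} → (X → Y) → X × ℕ → Y × ℕ
  (f ×id) z = f (proj₁ z) , proj₂ z

  record RelObj : Set₁ where
    field
      carrier : Set
      rel     : carrier → carrier → Set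
  open RelObj public

  record RelHom (A B : RelObj) : Set where
    field
      fun  : carrier A → carrier B
      pres : ∀ {x y} → rel A x y → rel B (fun x) (fun y)
  open RelHom public

  _∘R_ : ∀ {A B C} → RelHom B C → RelHom A B → RelHom A C
  g ∘R f = record { fun = λ x → fun g (fun f x) ; pres = λ r → pres g (pres f r) }

  record RelNObj : Set₁ where
    field
      carrierN : Set
      relN     : ℕ → carrierN → carrierN → Set
  open RelNObj public

  record RelNHom (A B : RelNObj) : Set where
    field
      funN  : carrierN A → carrierN B
      presN : ∀ n {x y} → relN A n x y → relN B n (funN x) (funN y)
  open RelNHom public

  U : RelNObj → RelObj
  U X = record { carrier = carrierN X ; rel = λ x y → ∃ λ n → relN X n x y }

  U₁ : ∀ {X Y} → RelNHom X Y → RelHom (U X) (U Y)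
  U₁ f = record { fun = funN f ; pres = λ r → proj₁ r , presN f (proj₁ r) (proj₂ r) }

  F̂ : RelObj → RelObj
  F̂ X = record
    { carrier = F₀ (carrier X)
    ; rel = λ u v → (proj₁ u ≤ᵇ proj₁ v) × (∀ a → rel X (proj₂ u a) (proj₂ v a)) }

  F̂₁ : ∀ {X Y} → RelHom X Y → RelHom (F̂ X) (F̂ Y)
  F̂₁ f = record { fun = F₁ (fun f) ; pres = λ r → proj₁ r , (λ a → pres f (proj₂ r a)) }

  F̂ᴺ : RelNObj → RelNObj
  F̂ᴺ X = record
    { carrierN = F₀ (carrierN X)
    ; relN = λ n u v → (proj₁ u ≤ᵇ proj₁ v) × (∀ a → relN X n (proj₂ u a) (proj₂ v a)) }

  F̂ᴺ₁ : ∀ {X Y} → RelNHom X Y → RelNHom (F̂ᴺ X) (F̂ᴺ Y)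
  F̂ᴺ₁ f = record { funN = F₁ (funN f) ; presN = λ n r → proj₁ r , (λ a → presN f n (proj₂ r a)) }

  -- M : Rel^ℕ_Δ → Rel^ℕ_Δ
  -- M(A)_n = {((s₁,n₁),(s₂,n₂)) | n₁ ≤ n + n₂, (s₁,s₂) ∈ A_{n-n₁+n₂}}
  -- (under n₁ ≤ n + n₂, the index n - n₁ + n₂ equals (n + n₂) ∸ n₁)
  M : RelNObj → RelNObj
  M X = record
    { carrierN = carrierN X × ℕ
    ; relN = λ n z₁ z₂ → (proj₂ z₁ ≤ n + proj₂ z₂)
                       × relN X ((n + proj₂ z₂) ∸ proj₂ z₁) (proj₁ z₁) (proj₁ z₂) }

  M₁ : ∀ {X Y} → RelNHom X Y → RelNHom (M X) (M Y)
  M₁ f = record { funN = funN f ×id ; presN = λ n r → proj₁ r , presN f _ (proj₂ r) }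

  record Epsilon : Set₁ where
    field
      comp    : (X : RelNObj) → RelHom (U (M X)) (U X)
      natural : ∀ {X Y} (f : RelNHom X Y) (z : carrierN X × ℕ)
                → fun (comp Y) (fun (U₁ (M₁ f)) z) ≡ fun (U₁ f) (fun (comp X) z)
      above   : ∀ X (z : carrierN X × ℕ) → fun (comp X) z ≡ proj₁ z

  record Alpha : Set₁ where
    field
      comp     : (X : RelNObj) → RelHom (U (F̂ᴺ X)) (F̂ (U X))
      natural  : ∀ {X Y} (f : RelNHom X Y) (u : F₀ (carrierN X))
                 → fun (comp Y) (fun (U₁ (F̂ᴺ₁ f)) u) ≈F fun (F̂₁ (U₁ f)) (fun (comp X) u)
      vertical : ∀ X (u : F₀ (carrierN X)) → fun (comp X) u ≈F u

  γ : Epsilon → Alpha → (X : RelNObj) → RelHom (U (F̂ᴺ (M X))) (F̂ (U X))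
  γ ε α X = F̂₁ (Epsilon.comp ε X) ∘R Alpha.comp α (M X)

  record CoalgNM : Set₁ where
    field
      obj : RelNObj
      str : RelNHom obj (F̂ᴺ (M obj))

  record HomNM (C D : CoalgNM) : Set where
    field
      map  : RelNHom (CoalgNM.obj C) (CoalgNM.obj D)
      comm : ∀ x → funN (CoalgNM.str D) (funN map x)
                     ≈F funN (F̂ᴺ₁ (M₁ map)) (funN (CoalgNM.str C) x)

  record CoalgF̂ : Set₁ where
    field
      obj : RelObj
      str : RelHom obj (F̂ obj)

  record HomF̂ (C D : CoalgF̂) : Set where
    field
      map  : RelHom (CoalgF̂.obj C) (CoalgF̂.obj D)
      comm : ∀ x → fun (CoalgF̂.str D) (fun map x) ≈F fun (F̂₁ map) (fun (CoalgF̂.str C) x)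

  record CoalgF : Set₁ where
    field
      car : Set
      str : car → F₀ car

  record HomF (C D : CoalgF) : Set where
    field
      map  : CoalgF.car C → CoalgF.car D
      comm : ∀ x → CoalgF.str D (map x) ≈F F₁ map (CoalgF.str C x)

  record CoalgFN : Set₁ where
    field
      car : Set
      str : car → F₀ (car × ℕ)

  record HomFN (C D : CoalgFN) : Set where
    field
      map  : CoalgFN.car C → CoalgFN.car D
      comm : ∀ x → CoalgFN.str D (map x) ≈F F₁ (map ×id) (CoalgFN.str C x)

  Coalgp : CoalgF̂ → CoalgF
  Coalgp C = record { car = carrier (CoalgF̂.obj C) ; str = fun (CoalgF̂.str C) }

  Coalgp₁ : ∀ {C D} → HomF̂ C D → HomF (Coalgp C) (Coalgp D)
  Coalgp₁ h = record { map = fun (HomF̂.map h) ; comm = HomF̂.comm h }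

  Coalgq : CoalgNM → CoalgFN
  Coalgq C = record { car = carrierN (CoalgNM.obj C) ; str = funN (CoalgNM.str C) }

  Coalgq₁ : ∀ {C D} → HomNM C D → HomFN (Coalgq C) (Coalgq D)
  Coalgq₁ h = record { map = funN (HomNM.map h) ; comm = HomNM.comm h }

  CoalgFπ : CoalgFN → CoalgF
  CoalgFπ C = record { car = CoalgFN.car C ; str = λ x → F₁ proj₁ (CoalgFN.str C x) }

  CoalgFπ₁ : ∀ {C D} → HomFN C D → HomF (CoalgFπ C) (CoalgFπ D)
  CoalgFπ₁ h = record { map = HomFN.map h ; comm = λ x → F₁-resp proj₁ (HomFN.comm h x) }

  CoalgUγ : Epsilon → Alpha → CoalgNM → CoalgF̂
  CoalgUγ ε α C = record
    { obj = U (CoalgNM.obj C)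
    ; str = γ ε α (CoalgNM.obj C) ∘R U₁ (CoalgNM.str C) }

  γ-above : ∀ (ε : Epsilon) (α : Alpha) X (u : F₀ (carrierN X × ℕ))
            → fun (γ ε α X) u ≈F F₁ proj₁ u
  γ-above ε α X u =
    proj₁ (Alpha.vertical α (M X) u)
    , (λ a → trans (Epsilon.above ε X _) (cong proj₁ (proj₂ (Alpha.vertical α (M X) u) a)))

  CoalgUγ₁ : ∀ (ε : Epsilon) (α : Alpha) {C D} → HomNM C D
             → HomF̂ (CoalgUγ ε α C) (CoalgUγ ε α D)
  CoalgUγ₁ ε α {C} {D} h = record
    { map = U₁ (HomNM.map h)
    ; comm = λ x →
        ≈F-trans (γ-above ε α (CoalgNM.obj D) _)
          (≈F-trans (F₁-resp proj₁ (HomNM.comm h x))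
            (F₁-resp (funN (HomNM.map h))
              (≈F-sym (γ-above ε α (CoalgNM.obj C) _)))) }

{-# OPTIONS --safe #-}
-- ε forgets the index, and a pair related in M(A) at grade n is related in A at
-- grade (n + n₂) ∸ n₁; α is the identity, which is allowed because an
-- (∃ grade, ∀ letter) witness gives a (∀ letter, ∃ grade) one. The square then
-- commutes for every ε above π₁ and every vertical α, since γ lies above Fπ₁.
module Submission where

open import Defs
open import Data.Product.Base using (Σ; _×_; _,_; proj₁)
open import Relation.Binary.PropositionalEquality using (_≡_; refl)

module _ (Sig : Set) where
  open Setting Sig

  ε-π₁ : Epsilon
  ε-π₁ = record
    { comp    = λ _ → record { fun = proj₁ ; pres = λ (_ , _ , r) → _ , r }
    ; natural = λ _ _ → refl
    ; above   = λ _ _ → refl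
    }

  α-id : Alpha
  α-id = record
    { comp     = λ _ → record { fun = λ u → u ; pres = λ (n , b , r) → b , λ a → n , r a }
    ; natural  = λ _ _ → ≈F-refl
    ; vertical = λ _ _ → ≈F-refl
    }

  Coalgp∘CoalgUγ≈CoalgFπ∘Coalgq : ∀ ε α (C : CoalgNM) x →
    CoalgF.str (Coalgp (CoalgUγ ε α C)) x ≈F CoalgF.str (CoalgFπ (Coalgq C)) x
  Coalgp∘CoalgUγ≈CoalgFπ∘Coalgq ε α C x = γ-above ε α (CoalgNM.obj C) (funN (CoalgNM.str C) x)

  Coalgp₁∘CoalgUγ₁≡CoalgFπ₁∘Coalgq₁ : ∀ ε α {C D} (h : HomNM C D) x →
    HomF.map (Coalgp₁ (CoalgUγ₁ ε α h)) x ≡ HomF.map (CoalgFπ₁ (Coalgq₁ h)) x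
  Coalgp₁∘CoalgUγ₁≡CoalgFπ₁∘Coalgq₁ ε α h x = refl

proposition4 : (Sig : Set) → let open Setting Sig in
    Σ Epsilon λ ε → Σ Alpha λ α →
      ((C : CoalgNM) → ∀ x →
          CoalgF.str (Coalgp (CoalgUγ ε α C)) x ≈F CoalgF.str (CoalgFπ (Coalgq C)) x)
      × (∀ {C D} (h : HomNM C D) → ∀ x →
          HomF.map (Coalgp₁ (CoalgUγ₁ ε α h)) x ≡ HomF.map (CoalgFπ₁ (Coalgq₁ h)) x)
proposition4 Sig =
  ε-π₁ Sig , α-id Sig ,
  Coalgp∘CoalgUγ≈CoalgFπ∘Coalgq Sig (ε-π₁ Sig) (α-id Sig) ,
  Coalgp₁∘CoalgUγ₁≡CoalgFπ₁∘Coalgq₁ Sig (ε-π₁ Sig) (α-id Sig)
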